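{- Every finite twin-free interval order $P=(X,\prec)$ has a closed interval representation satisfying the following peeking property: for each pair $u,v\in X$ with $I(u)\subsetneq I(v)$ there exist $x,y\in X$ such that $x$ peeks into $vu$ from the left and $y$ peeks into $vu$ from the right.
   Context: Posets are strict partial orders on a finite set. A closed interval representation of $P$ assigns to each $x\in X$ a closed real interval $I(x)=[L(x),R(x)]$ so that $x\prec y$ iff $R(x)<L(y)$; $P$ is an interval order if it has one. Two elements are twins if they have exactly the same comparabilities; $P$ is twin-free if it has no twins. For $x,u,v\in X$ with $I(u)\subset I(v)$, $x$ peeks into $vu$ if $I(x)$ intersects $I(v)$ but not $I(u)$; it peeks into $vu$ from the left if in addition $R(x)\le L(u)$, and from the right if in addition $R(u)\le L(x)$.
   Formalization: The closed intervals $I(x)=[L(x),R(x)]$ have endpoints in ℚ rather than in the reals. -}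

module Defs where

open import Data.Nat using (ℕ)
open import Data.Fin using (Fin)
open import Data.Rational using (ℚ; _≤_; _<_)
open import Data.Product using (Σ; ∃; _×_; _,_)
open import Data.Sum using (_⊎_)
open import Relation.Nullary using (¬_)
open import Relation.Binary.PropositionalEquality using (_≡_; _≢_)
open import Relation.Binary.Structures using (IsStrictPartialOrder)
open import Function.Bundles using (_⇔_)

record FinPoset : Set₁ where
  field
    n     : ℕ
    _≺_   : Fin n → Fin n → Set
    isSPO : IsStrictPartialOrder _≡_ _≺_

record Interval : Set where
  constructor [_,_]
  field
    L : ℚ
    R : ℚ
open Interval public

record ClosedIntervalRep (P : FinPoset) : Set where
  open FinPoset P
  field
    I       : Fin n → Interval
    nonempty : ∀ x → L (I x) ≤ R (I x)
    rep      : ∀ x y → (x ≺ y) ⇔ (R (I x) < L (I y))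

IsIntervalOrder : FinPoset → Set
IsIntervalOrder P = ClosedIntervalRep P

Twins : (P : FinPoset) → Fin (FinPoset.n P) → Fin (FinPoset.n P) → Set
Twins P x y = x ≢ y × (∀ z → ((z ≺ x) ⇔ (z ≺ y)) × ((x ≺ z) ⇔ (y ≺ z)))
  where open FinPoset P

TwinFree : FinPoset → Set
TwinFree P = ∀ x y → ¬ Twins P x y

_⊆ᴵ_ : Interval → Interval → Set
J ⊆ᴵ K = (L K ≤ L J) × (R J ≤ R K)

_⊂ᴵ_ : Interval → Interval → Set
J ⊂ᴵ K = J ⊆ᴵ K × ¬ ((L J ≡ L K) × (R J ≡ R K))

Intersects : Interval → Interval → Set
Intersects J K = (L J ≤ R K) × (L K ≤ R J)

PeeksInto : Interval → Interval → Interval → Set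
PeeksInto X V U = Intersects X V × ¬ Intersects X U

PeeksLeft : Interval → Interval → Interval → Set
PeeksLeft X V U = PeeksInto X V U × (R X ≤ L U)

PeeksRight : Interval → Interval → Interval → Set
PeeksRight X V U = PeeksInto X V U × (R U ≤ L X)

HasPeekingProperty : (P : FinPoset) → ClosedIntervalRep P → Set
HasPeekingProperty P ρ =
  ∀ u v → I u ⊂ᴵ I v →
    Σ (Fin n) (λ x → Σ (Fin n) (λ y →
      PeeksLeft (I x) (I v) (I u) × PeeksRight (I y) (I v) (I u)))
  where
    open FinPoset P
    open ClosedIntervalRep ρ

module Submission where

-- The down-sets D(y) = {z | z ≺ y}
-- form a chain, so an element y is described by the number ℓ(y) = |D(y)|
-- and an element x by b(x) = |B(x)|, where B(x) = {z | z ≺ y for every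
-- y ≻ x} is the set of elements below all successors of x.  One checks
--   x ≺ y  ⇔  b(x) ≤ ℓ(y)                                        (★)
-- and ℓ(x) < b(x).  The canonical representation puts, with M = n + 1,
--   L(y) = M·(2ℓ(y) + 1) + b(y)      R(x) = M·(2b(x)) + ℓ(x);
-- the leading terms realise (★) and the small second terms break ties.
-- If I(u) ⊊ I(v), the tie-breakers and twin-freeness (equal profiles
-- (ℓ, b) give twins) force ℓ(v) < ℓ(u) and b(u) < b(v).  A counting
-- argument then yields x ≺ u with x ⊀ v and y ≻ u with v ⊀ y, and in any
-- representation such x, y peek into vu from the left and from the right.

open import Defs
open import Data.Product using (Σ; ∃; _×_; _,_)
open import Data.Sum as Sum using (_⊎_; inj₁; inj₂)
open import Data.Bool using (true)
open import Data.Nat as ℕ using (ℕ; suc; _+_; _*_; s≤s)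
open import Data.Nat.Properties as ℕP using (module ≤-Reasoning)
open import Data.Fin using (Fin)
open import Data.Fin.Properties using (any?; all?; ¬∀⟶∃¬)
open import Data.Fin.Subset using (Subset; _∈_; _⊆_; ∣_∣)
open import Data.Fin.Subset.Properties using (p⊆q⇒∣p∣≤∣q∣; p⊂q⇒∣p∣<∣q∣; ∣p∣≤n)
open import Data.Vec using (tabulate)
open import Data.Vec.Properties using (lookup∘tabulate; lookup⇒[]=; []=⇒lookup)
open import Data.Integer as ℤ using (+_)
import Data.Integer.Properties as ℤP
open import Data.Rational as ℚ using (ℚ; mkℚ; *<*; *≤*)
import Data.Rational.Properties as ℚP
open import Data.Nat.Coprimality using (1-coprimeTo) renaming (sym to coprime-sym)
open import Level using (0ℓ)
open import Relation.Unary using (Pred; Decidable)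
open import Relation.Nullary using (¬_; Dec; yes; no; does; contradiction)
open import Relation.Nullary.Decidable using (dec-true; _×-dec_; ¬?; _→-dec_; map′)
open import Relation.Binary.PropositionalEquality
  using (_≡_; _≢_; refl; sym; trans; subst; subst₂)
open import Relation.Binary.Structures using (IsStrictPartialOrder)
open import Relation.Binary.Definitions using (tri<; tri≈; tri>)
open import Function.Bundles using (mk⇔; Equivalence)

-- The embedding ℕ → ℚ preserves and reflects < and ≤; the canonical
-- representation has natural-number endpoints, reasoned about in ℕ.

toℚ : ℕ → ℚ
toℚ m = mkℚ (+ m) 0 (coprime-sym (1-coprimeTo m))

-- The cross-multiplied numerators of toℚ m and toℚ k are + m and + k.
+m*1 : ∀ m → + m ℤ.* + 1 ≡ + m
+m*1 m = ℤP.*-identityʳ (+ m)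

toℚ-mono-≤ : ∀ {m k} → m ℕ.≤ k → toℚ m ℚ.≤ toℚ k
toℚ-mono-≤ {m} {k} m≤k = *≤* (subst₂ ℤ._≤_ (sym (+m*1 m)) (sym (+m*1 k)) (ℤ.+≤+ m≤k))

toℚ-mono-< : ∀ {m k} → m ℕ.< k → toℚ m ℚ.< toℚ k
toℚ-mono-< {m} {k} m<k = *<* (subst₂ ℤ._<_ (sym (+m*1 m)) (sym (+m*1 k)) (ℤ.+<+ m<k))

toℚ-cancel-≤ : ∀ {m k} → toℚ m ℚ.≤ toℚ k → m ℕ.≤ k
toℚ-cancel-≤ {m} {k} p = ℤP.drop‿+≤+ (subst₂ ℤ._≤_ (+m*1 m) (+m*1 k) (ℚP.drop-*≤* p))

toℚ-cancel-< : ∀ {m k} → toℚ m ℚ.< toℚ k → m ℕ.< k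
toℚ-cancel-< {m} {k} p = ℤP.drop‿+<+ (subst₂ ℤ._<_ (+m*1 m) (+m*1 k) (ℚP.drop-*<* p))

-- Lexicographic encoding: for second components below M, the number
-- M·p + s compares the pairs (p , s) lexicographically.

lex-< : ∀ {M p q s t} → s ℕ.< M → p ℕ.< q → M * p + s ℕ.< M * q + t
lex-< {M} {p} {q} {s} {t} s<M p<q = begin-strict
  M * p + s      <⟨ ℕP.+-monoʳ-< (M * p) s<M ⟩
  M * p + M      ≡⟨ ℕP.+-comm (M * p) M ⟩
  M + M * p      ≡⟨ sym (ℕP.*-suc M p) ⟩
  M * suc p      ≤⟨ ℕP.*-monoʳ-≤ M p<q ⟩
  M * q          ≤⟨ ℕP.m≤m+n (M * q) t ⟩
  M * q + t      ∎
  where open ≤-Reasoning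

lex-≤⁻ : ∀ {M p q s t} → t ℕ.< M → M * p + s ℕ.≤ M * q + t →
         p ℕ.< q ⊎ (p ≡ q × s ℕ.≤ t)
lex-≤⁻ {M} {p} {q} {s} {t} t<M le with ℕP.<-cmp p q
... | tri< p<q _ _ = inj₁ p<q
... | tri≈ _ refl _ = inj₂ (refl , ℕP.+-cancelˡ-≤ (M * p) s t le)
... | tri> _ _ q<p = contradiction le (ℕP.<⇒≱ (lex-< t<M q<p))

even<odd : ∀ {m n} → m ℕ.≤ n → 2 * m ℕ.< suc (2 * n)
even<odd m≤n = s≤s (ℕP.*-monoʳ-≤ 2 m≤n)

odd<even : ∀ {m n} → m ℕ.< n → suc (2 * m) ℕ.< 2 * n
odd<even {m} {n} m<n = subst (ℕ._≤ 2 * n) (ℕP.*-suc 2 m) (ℕP.*-monoʳ-≤ 2 m<n)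

-- The subset ⟦ P? ⟧ cut out
-- by a decidable predicate has exactly the members satisfying it, so the
-- library's monotonicity of ∣_∣ transfers to predicates.

module _ {n : ℕ} where

  ⟦_⟧ : {P : Pred (Fin n) 0ℓ} → Decidable P → Subset n
  ⟦ P? ⟧ = tabulate (λ i → does (P? i))

  ∈⟦⟧⁺ : ∀ {P : Pred (Fin n) 0ℓ} (P? : Decidable P) {i} → P i → i ∈ ⟦ P? ⟧
  ∈⟦⟧⁺ P? {i} Pi =
    lookup⇒[]= i ⟦ P? ⟧ (trans (lookup∘tabulate _ i) (dec-true (P? i) Pi))

  ∈⟦⟧⁻ : ∀ {P : Pred (Fin n) 0ℓ} (P? : Decidable P) {i} → i ∈ ⟦ P? ⟧ → P i
  ∈⟦⟧⁻ P? {i} i∈ = does-true (P? i) (trans (sym (lookup∘tabulate _ i)) ([]=⇒lookup i∈))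
    where
      does-true : ∀ {A : Set} (a? : Dec A) → does a? ≡ true → A
      does-true (yes a) _ = a

  module _ {P Q : Pred (Fin n) 0ℓ} (P? : Decidable P) (Q? : Decidable Q) where

    ⟦⟧-mono : (∀ {i} → P i → Q i) → ⟦ P? ⟧ ⊆ ⟦ Q? ⟧
    ⟦⟧-mono P⇒Q i∈ = ∈⟦⟧⁺ Q? (P⇒Q (∈⟦⟧⁻ P? i∈))

    ∣⟦⟧∣-mono : (∀ {i} → P i → Q i) → ∣ ⟦ P? ⟧ ∣ ℕ.≤ ∣ ⟦ Q? ⟧ ∣
    ∣⟦⟧∣-mono P⇒Q = p⊆q⇒∣p∣≤∣q∣ (⟦⟧-mono P⇒Q)

    ∣⟦⟧∣-strict : (∀ {i} → P i → Q i) → ∀ j → Q j → ¬ P j →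
                  ∣ ⟦ P? ⟧ ∣ ℕ.< ∣ ⟦ Q? ⟧ ∣
    ∣⟦⟧∣-strict P⇒Q j Qj ¬Pj =
      p⊂q⇒∣p∣<∣q∣ (⟦⟧-mono P⇒Q , j , ∈⟦⟧⁺ Q? Qj , λ j∈ → ¬Pj (∈⟦⟧⁻ P? j∈))

  ∣⟦⟧∣<⇒witness : ∀ {P Q : Pred (Fin n) 0ℓ} (P? : Decidable P) (Q? : Decidable Q) →
                  ∣ ⟦ P? ⟧ ∣ ℕ.< ∣ ⟦ Q? ⟧ ∣ → ∃ λ j → Q j × ¬ P j
  ∣⟦⟧∣<⇒witness {P} {Q} P? Q? lt with any? (λ j → Q? j ×-dec ¬? (P? j))
  ... | yes witness = witness
  ... | no none = contradiction (∣⟦⟧∣-mono Q? P? Q⇒P) (ℕP.<⇒≱ lt)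
    where
      Q⇒P : ∀ {j} → Q j → P j
      Q⇒P {j} Qj with P? j
      ... | yes Pj = Pj
      ... | no ¬Pj = contradiction (j , Qj , ¬Pj) none

module Peeking (P : FinPoset) (ρ : ClosedIntervalRep P) where
  open FinPoset P
  open ClosedIntervalRep ρ

  <⇒≱ : ∀ {p q} → p ℚ.< q → ¬ q ℚ.≤ p
  <⇒≱ p<q q≤p = ℚP.<-irrefl refl (ℚP.<-≤-trans p<q q≤p)

  ≺⇒R<L : ∀ {x y} → x ≺ y → R (I x) ℚ.< L (I y)
  ≺⇒R<L {x} {y} = Equivalence.to (rep x y)

  ⊀⇒L≤R : ∀ {x y} → ¬ x ≺ y → L (I y) ℚ.≤ R (I x)
  ⊀⇒L≤R {x} {y} x⊀y = ℚP.≮⇒≥ (λ lt → x⊀y (Equivalence.from (rep x y) lt))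

  peeks-left : ∀ {x u v} → x ≺ u → ¬ x ≺ v → I u ⊆ᴵ I v → PeeksLeft (I x) (I v) (I u)
  peeks-left {x} {u} {v} x≺u x⊀v (_ , Ru≤Rv) =
    ((Lx≤Rv , ⊀⇒L≤R x⊀v) , (λ (_ , Lu≤Rx) → <⇒≱ Rx<Lu Lu≤Rx)) , ℚP.<⇒≤ Rx<Lu
    where
      Rx<Lu : R (I x) ℚ.< L (I u)
      Rx<Lu = ≺⇒R<L x≺u
      Lx≤Rv : L (I x) ℚ.≤ R (I v)
      Lx≤Rv = ℚP.≤-trans (nonempty x)
                (ℚP.≤-trans (ℚP.<⇒≤ Rx<Lu) (ℚP.≤-trans (nonempty u) Ru≤Rv))

  peeks-right : ∀ {y u v} → u ≺ y → ¬ v ≺ y → I u ⊆ᴵ I v → PeeksRight (I y) (I v) (I u)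
  peeks-right {y} {u} {v} u≺y v⊀y (Lv≤Lu , _) =
    ((⊀⇒L≤R v⊀y , Lv≤Ry) , (λ (Ly≤Ru , _) → <⇒≱ Ru<Ly Ly≤Ru)) , ℚP.<⇒≤ Ru<Ly
    where
      Ru<Ly : R (I u) ℚ.< L (I y)
      Ru<Ly = ≺⇒R<L u≺y
      Lv≤Ry : L (I v) ℚ.≤ R (I y)
      Lv≤Ry = ℚP.≤-trans Lv≤Lu
                (ℚP.≤-trans (nonempty u) (ℚP.≤-trans (ℚP.<⇒≤ Ru<Ly) (nonempty y)))

module Canonical (P : FinPoset) (ρ : ClosedIntervalRep P) where
  open FinPoset P
  open ClosedIntervalRep ρ using (I; rep)
  open Peeking P ρ using (≺⇒R<L; ⊀⇒L≤R)

  _≺?_ : ∀ x y → Dec (x ≺ y)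
  x ≺? y = map′ (Equivalence.from (rep x y)) (Equivalence.to (rep x y)) (R (I x) ℚ.<? L (I y))

  -- P has no induced 2 + 2: if x lies below y' but not below y, then every
  -- element below y lies below y'.  Hence the down-sets form a chain.
  down-chain : ∀ {x y y′ z} → x ≺ y′ → ¬ x ≺ y → z ≺ y → z ≺ y′
  down-chain {x} {y} {y′} {z} x≺y′ x⊀y z≺y = Equivalence.from (rep z y′) (begin-strict
    R (I z)   <⟨ ≺⇒R<L z≺y ⟩
    L (I y)   ≤⟨ ⊀⇒L≤R x⊀y ⟩
    R (I x)   <⟨ ≺⇒R<L x≺y′ ⟩
    L (I y′)  ∎)
    where open ℚP.≤-Reasoning

  BelowSuccessors : Fin n → Fin n → Set
  BelowSuccessors x z = ∀ y → x ≺ y → z ≺ y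

  below-successors? : ∀ x → Decidable (BelowSuccessors x)
  below-successors? x z = all? (λ y → (x ≺? y) →-dec (z ≺? y))

  ℓ b : Fin n → ℕ
  ℓ y = ∣ ⟦ (_≺? y) ⟧ ∣
  b x = ∣ ⟦ below-successors? x ⟧ ∣

  ≺⇒b≤ℓ : ∀ {x y} → x ≺ y → b x ℕ.≤ ℓ y
  ≺⇒b≤ℓ {x} {y} x≺y = ∣⟦⟧∣-mono (below-successors? x) (_≺? y) (λ below → below y x≺y)

  ⊀⇒ℓ<b : ∀ {x y} → ¬ x ≺ y → ℓ y ℕ.< b x
  ⊀⇒ℓ<b {x} {y} x⊀y = ∣⟦⟧∣-strict (_≺? y) (below-successors? x)
    (λ z≺y y′ x≺y′ → down-chain x≺y′ x⊀y z≺y) x (λ _ x≺y′ → x≺y′) x⊀y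

  b≤ℓ⇒≺ : ∀ {x y} → b x ℕ.≤ ℓ y → x ≺ y
  b≤ℓ⇒≺ {x} {y} b≤ℓ with x ≺? y
  ... | yes x≺y = x≺y
  ... | no x⊀y = contradiction b≤ℓ (ℕP.<⇒≱ (⊀⇒ℓ<b x⊀y))

  -- ℓ and b are at most n, so M = n + 1 bounds every tie-breaker.
  M : ℕ
  M = suc n

  ℓ<M : ∀ y → ℓ y ℕ.< M
  ℓ<M y = s≤s (∣p∣≤n ⟦ (_≺? y) ⟧)

  b<M : ∀ x → b x ℕ.< M
  b<M x = s≤s (∣p∣≤n ⟦ below-successors? x ⟧)

  Lᶜ Rᶜ : Fin n → ℕ
  Lᶜ y = M * suc (2 * ℓ y) + b y
  Rᶜ x = M * (2 * b x) + ℓ x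

  ≺⇒Rᶜ<Lᶜ : ∀ {x y} → x ≺ y → Rᶜ x ℕ.< Lᶜ y
  ≺⇒Rᶜ<Lᶜ {x} x≺y = lex-< (ℓ<M x) (even<odd (≺⇒b≤ℓ x≺y))

  ⊀⇒Lᶜ<Rᶜ : ∀ {x y} → ¬ x ≺ y → Lᶜ y ℕ.< Rᶜ x
  ⊀⇒Lᶜ<Rᶜ {y = y} x⊀y = lex-< (b<M y) (odd<even (⊀⇒ℓ<b x⊀y))

  Rᶜ<Lᶜ⇒≺ : ∀ {x y} → Rᶜ x ℕ.< Lᶜ y → x ≺ y
  Rᶜ<Lᶜ⇒≺ {x} {y} lt with x ≺? y
  ... | yes x≺y = x≺y
  ... | no x⊀y = contradiction lt (ℕP.<-asym (⊀⇒Lᶜ<Rᶜ x⊀y))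

  Iᶜ : Fin n → Interval
  Iᶜ x = [ toℚ (Lᶜ x) , toℚ (Rᶜ x) ]

  canonical : ClosedIntervalRep P
  canonical = record
    { I        = Iᶜ
    ; nonempty = λ x → toℚ-mono-≤ (ℕP.<⇒≤ (⊀⇒Lᶜ<Rᶜ (IsStrictPartialOrder.irrefl isSPO refl)))
    ; rep      = λ x y → mk⇔ (λ x≺y → toℚ-mono-< (≺⇒Rᶜ<Lᶜ x≺y)) (λ lt → Rᶜ<Lᶜ⇒≺ (toℚ-cancel-< lt))
    }

  Lᶜ-≤⁻ : ∀ {u v} → Lᶜ v ℕ.≤ Lᶜ u → ℓ v ℕ.< ℓ u ⊎ (ℓ v ≡ ℓ u × b v ℕ.≤ b u)
  Lᶜ-≤⁻ {u} le = Sum.map (λ lt → ℕP.*-cancelˡ-< 2 _ _ (ℕ.s<s⁻¹ lt))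
    (λ (e , b≤b) → ℕP.*-cancelˡ-≡ _ _ 2 (ℕP.suc-injective e) , b≤b) (lex-≤⁻ (b<M u) le)

  Rᶜ-≤⁻ : ∀ {u v} → Rᶜ u ℕ.≤ Rᶜ v → b u ℕ.< b v ⊎ (b u ≡ b v × ℓ u ℕ.≤ ℓ v)
  Rᶜ-≤⁻ {v = v} le = Sum.map (ℕP.*-cancelˡ-< 2 _ _)
    (λ (e , ℓ≤ℓ) → ℕP.*-cancelˡ-≡ _ _ 2 e , ℓ≤ℓ) (lex-≤⁻ (ℓ<M v) le)

  -- By (★) the profile (ℓ , b) determines all comparabilities, so two
  -- distinct elements with the same profile are twins.
  equal-profiles⇒twins : ∀ {u v} → u ≢ v → ℓ u ≡ ℓ v → b u ≡ b v → Twins P u v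
  equal-profiles⇒twins {u} {v} u≢v ℓu≡ℓv bu≡bv = u≢v , λ z →
    mk⇔ (λ z≺u → b≤ℓ⇒≺ (subst (b z ℕ.≤_) ℓu≡ℓv (≺⇒b≤ℓ z≺u)))
        (λ z≺v → b≤ℓ⇒≺ (subst (b z ℕ.≤_) (sym ℓu≡ℓv) (≺⇒b≤ℓ z≺v))) ,
    mk⇔ (λ u≺z → b≤ℓ⇒≺ (subst (ℕ._≤ ℓ z) bu≡bv (≺⇒b≤ℓ u≺z)))
        (λ v≺z → b≤ℓ⇒≺ (subst (ℕ._≤ ℓ z) (sym bu≡bv) (≺⇒b≤ℓ v≺z)))

  ⊂ᶜ⇒profile-gaps : TwinFree P → ∀ {u v} → Iᶜ u ⊂ᴵ Iᶜ v → ℓ v ℕ.< ℓ u × b u ℕ.< b v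
  ⊂ᶜ⇒profile-gaps tf {u} {v} ((Lv≤Lu , Ru≤Rv) , Iu≢Iv)
    with Lᶜ-≤⁻ {u} {v} (toℚ-cancel-≤ Lv≤Lu) | Rᶜ-≤⁻ {u} {v} (toℚ-cancel-≤ Ru≤Rv)
  ... | inj₁ ℓv<ℓu        | inj₁ bu<bv        = ℓv<ℓu , bu<bv
  ... | inj₁ ℓv<ℓu        | inj₂ (_ , ℓu≤ℓv)  = contradiction ℓu≤ℓv (ℕP.<⇒≱ ℓv<ℓu)
  ... | inj₂ (_ , bv≤bu)  | inj₁ bu<bv        = contradiction bv≤bu (ℕP.<⇒≱ bu<bv)
  ... | inj₂ (ℓv≡ℓu , _)  | inj₂ (bu≡bv , _)  =
    contradiction (equal-profiles⇒twins u≢v (sym ℓv≡ℓu) bu≡bv) (tf u v)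
    where
      u≢v : u ≢ v
      u≢v refl = Iu≢Iv (refl , refl)

  left-peeker : ∀ {u v} → ℓ v ℕ.< ℓ u → ∃ λ x → x ≺ u × ¬ x ≺ v
  left-peeker {u} {v} = ∣⟦⟧∣<⇒witness (_≺? v) (_≺? u)

  -- A gap in b yields an element above u but not above v: some z lies
  -- below all successors of v but misses a successor y of u.
  right-peeker : ∀ {u v} → b u ℕ.< b v → ∃ λ y → u ≺ y × ¬ v ≺ y
  right-peeker {u} {v} bu<bv
    with ∣⟦⟧∣<⇒witness (below-successors? u) (below-successors? v) bu<bv
  ... | z , z-below-v , z-not-below-u
    with ¬∀⟶∃¬ n _ (λ y → (u ≺? y) →-dec (z ≺? y)) z-not-below-u
  ... | y , ¬[u≺y⇒z≺y] with u ≺? y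
  ...   | yes u≺y = y , u≺y , λ v≺y → ¬[u≺y⇒z≺y] (λ _ → z-below-v y v≺y)
  ...   | no u⊀y = contradiction (λ u≺y → contradiction u≺y u⊀y) ¬[u≺y⇒z≺y]

  peeking : TwinFree P → HasPeekingProperty P canonical
  peeking tf u v Iu⊂Iv@(Iu⊆Iv , _) =
    let (ℓv<ℓu , bu<bv) = ⊂ᶜ⇒profile-gaps tf Iu⊂Iv
        (x , x≺u , x⊀v) = left-peeker ℓv<ℓu
        (y , u≺y , v⊀y) = right-peeker bu<bv
    in x , y , peeks-left x≺u x⊀v Iu⊆Iv , peeks-right u≺y v⊀y Iu⊆Iv
    where open Peeking P canonical

theorem11 : (P : FinPoset) → IsIntervalOrder P → TwinFree P →
    Σ (ClosedIntervalRep P) (λ ρ → HasPeekingProperty P ρ)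
theorem11 P ρ tf = canonical , peeking tf
  where open Canonical P ρ
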